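{- Let $n\ge2$, $m\ge2$, let $M_1$ be the $n\times n$ $0/1$ matrix with $(M_1)_{1,n-1}=(M_1)_{1,n}=1$, $(M_1)_{i+1,i}=1$ for $i=1,\dots,n-1$, and all other entries $0$, and let $\mathbb{A}_0=(a_{i_1\cdots i_m})$ be the tensor of order $m$ and dimension $n$ with $a_{ii_2\cdots i_m}=0$ unless $i_2=\cdots=i_m$, and $a_{ij\cdots j}=(M_1)_{ij}$. Let $k$ be a positive integer with $1\le k\le n^2-3n+2$. Then $S_1(\mathbb{A}_0,n-1),S_2(\mathbb{A}_0,n-1),\dots,S_k(\mathbb{A}_0,n-1)$ are pairwise distinct proper subsets of $[n]$.
   Context: For a dimension-$n$ tensor $\mathbb{A}$ of order $m\ge2$ and a dimension-$n$ tensor $\mathbb{B}$ of order $p\ge1$, the product $\mathbb{A}\mathbb{B}$ is the dimension-$n$ tensor $\mathbb{D}$ of order $(m-1)(p-1)+1$ with $d_{i\alpha_1\cdots\alpha_{m-1}}=\sum_{i_2,\dots,i_m=1}^n a_{ii_2\cdots i_m}b_{i_2\alpha_1}\cdots b_{i_m\alpha_{m-1}}$ ($i\in[n]$, $\alpha_t\in[n]^{p-1}$). Powers: $\mathbb{A}^1=\mathbb{A}$, $\mathbb{A}^{k+1}=\mathbb{A}\mathbb{A}^k$. The majorization matrix $M(\mathbb{B})$ of a dimension-$n$ tensor $\mathbb{B}$ of order $\ge2$ is the $n\times n$ matrix with $(M(\mathbb{B}))_{ij}=b_{ij\cdots j}$. $S_k(\mathbb{A},j)=\{u\in[n]\mid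 (M(\mathbb{A}^k))_{uj}>0\}$. -}

module Defs where

open import Data.Nat using (ℕ; zero; suc; _+_; _*_; _<ᵇ_)
open import Data.Bool using (Bool; true; false; if_then_else_)
open import Data.Fin using (Fin; zero; suc; _≟_; toℕ)
open import Data.Fin.Subset using (Subset)
open import Data.List using (List; map; allFin)
open import Data.Nat.ListAction using (sum)
open import Data.Vec using (Vec; []; _∷_; take; drop; replicate; tabulate; lookup; foldr)
open import Relation.Nullary using (does)

-- A dimension-n tensor of order r with (nonnegative) natural-number entries:
-- a function from index vectors (i₁,…,i_r) ∈ [n]^r (0-based) to ℕ.
Tensor : ℕ → ℕ → Set
Tensor n r = Vec (Fin n) r → ℕ

sumAll : ∀ {n} (k : ℕ) → (Vec (Fin n) k → ℕ) → ℕ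
sumAll {n} zero    f = f []
sumAll {n} (suc k) f = sum (map (λ j → sumAll k (λ js → f (j ∷ js))) (allFin n))

chunks : ∀ {A : Set} (m p : ℕ) → Vec A (m * p) → Vec (Vec A p) m
chunks zero    p xs = []
chunks (suc m) p xs = take p xs ∷ chunks m p (drop p xs)

product : ∀ {k} → Vec ℕ k → ℕ
product = foldr _ _*_ 1

-- Tensor product  A B  for A of order m = suc m₁ and B of order p = suc p₁;
-- result has order (m-1)(p-1)+1 = suc (m₁ * p₁):
-- d_{i α₁ ⋯ α_{m-1}} = Σ_{i₂,…,i_m} a_{i i₂ ⋯ i_m} b_{i₂ α₁} ⋯ b_{i_m α_{m-1}}
tmul : ∀ {n} (m₁ p₁ : ℕ) → Tensor n (suc m₁) → Tensor n (suc p₁) → Tensor n (suc (m₁ * p₁))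
tmul m₁ p₁ A B (i ∷ rest) =
  sumAll m₁ (λ js → A (i ∷ js) *
    product (tabulate (λ t → B (lookup js t ∷ lookup (chunks m₁ p₁ rest) t))))

-- order of A^{k+1} minus one, for A of order suc m₁
powE : ℕ → ℕ → ℕ
powE m₁ zero    = m₁
powE m₁ (suc k) = m₁ * powE m₁ k

-- pow m₁ k A = A^{k+1}  (A^1 = A, A^{k+1} = A A^k)
pow : ∀ {n} (m₁ : ℕ) (k : ℕ) → Tensor n (suc m₁) → Tensor n (suc (powE m₁ k))
pow m₁ zero    A = A
pow m₁ (suc k) A = tmul m₁ (powE m₁ k) A (pow m₁ k A)

majorization : ∀ {n} (r : ℕ) → Tensor n (suc r) → Fin n → Fin n → ℕ
majorization r B i j = B (i ∷ replicate r j)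

-- S_k(A, j) = { u ∈ [n] | M(A^k)_{uj} > 0 }, for k ≥ 1; here  S m₁ k A j = S_{k+1}(A,j)
S : ∀ {n} (m₁ k : ℕ) → Tensor n (suc m₁) → Fin n → Subset n
S m₁ k A j = tabulate (λ u → 0 <ᵇ majorization (powE m₁ k) (pow m₁ k A) u j)

-- the matrix M₁ (0-based indices) for n = suc (suc n'):
-- (M₁)_{1,n-1} = (M₁)_{1,n} = 1, (M₁)_{i+1,i} = 1, all other entries 0.
M1 : (n' : ℕ) → Fin (suc (suc n')) → Fin (suc (suc n')) → ℕ
M1 n' i j =
  if does (toℕ i Data.Nat.≟ 0) then
    (if does (toℕ j Data.Nat.≟ n') then 1 else if does (toℕ j Data.Nat.≟ suc n') then 1 else 0)
  else (if does (toℕ i Data.Nat.≟ suc (toℕ j)) then 1 else 0)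

allEq : ∀ {n k} → Fin n → Vec (Fin n) k → Bool
allEq j []       = true
allEq j (x ∷ xs) = if does (x ≟ j) then allEq j xs else false

A0 : (n' m₂ : ℕ) → Tensor (suc (suc n')) (suc (suc m₂))
A0 n' m₂ (i ∷ j ∷ rest) = if allEq j rest then M1 n' i j else 0

module Submission where

-- Call a tensor diagonally supported if a_{i i₂ ⋯ i_m} = 0 unless i₂ = ⋯ = i_m.
-- For such a tensor the entry (u,v) of M(A^k) is positive exactly when the digraph of
-- M(A) has a walk of length k from u to v, so S_k(A,v) is the set of vertices that
-- reach v in exactly k steps.  For 𝔸₀ this digraph is the Wielandt digraph: the path
-- edges i+1 → i together with 1 → n-1 and 1 → n, i.e. two cycles through vertex 1 of
-- lengths n-1 and n.  (In the code vertices are 0-based: vertex 0 is the paper's 1 and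
-- the target c = n' is the paper's n-1, where n = n' + 2.)

open import Defs
open import Data.Nat using (ℕ; zero; suc; _+_; _*_; _∸_; _≤_; _<_; z≤n; s≤s; s≤s⁻¹; z<s; _≡ᵇ_; _<ᵇ_; >-nonZero)
open import Data.Nat.Properties
open import Data.Nat.DivMod using (_/_; _%_; m≡m%n+[m/n]*n; m%n<n; m<n*o⇒m/o<n; /-monoˡ-≤; m*n/n≡m)
open import Data.Nat.Tactic.RingSolver using (solve-∀)
open import Data.Nat.ListAction using (sum)
open import Data.Fin using (Fin; toℕ; fromℕ<; fromℕ; inject₁) renaming (zero to fzero; suc to fsuc)
open import Data.Fin.Properties using (toℕ-fromℕ<; toℕ-fromℕ; toℕ-inject₁; toℕ<n)
open import Data.Fin.Subset using (_⊂_; ⊤) renaming (_∈_ to _∈ₛ_)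
open import Data.Fin.Subset.Properties using (∈⊤)
open import Data.Vec using (Vec; []; _∷_; replicate; tabulate; lookup; take; drop)
open import Data.Vec.Properties using (lookup-replicate; lookup∘tabulate; []=⇒lookup; lookup⇒[]=)
open import Data.List using (List; map; allFin) renaming (_∷_ to _∷ₗ_)
open import Data.List.Relation.Unary.Any using (here; there)
open import Data.List.Membership.Propositional using (_∈_)
open import Data.List.Membership.Propositional.Properties using (∈-allFin)
open import Data.Bool using (Bool; true; false; T)
open import Data.Bool.Properties using (T-≡)
open import Data.Product using (Σ; ∃; _×_; _,_; proj₁)
open import Data.Sum using (_⊎_; inj₁; inj₂)
open import Function using (_∘_)
open import Function.Bundles using (_⇔_; mk⇔; Equivalence)
open import Relation.Nullary using (¬_; yes; no; contradiction)
open import Relation.Binary.PropositionalEquality using (_≡_; _≢_; refl; sym; trans; cong; subst; subst₂; module ≡-Reasoning)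

open Equivalence using (to; from)

sum-pos⁻ : ∀ {A : Set} (g : A → ℕ) (xs : List A) → 0 < sum (map g xs) → ∃ λ x → 0 < g x
sum-pos⁻ g (x ∷ₗ xs) p with g x in eq
... | zero  = sum-pos⁻ g xs p
... | suc _ = x , subst (0 <_) (sym eq) z<s

sum-pos⁺ : ∀ {A : Set} (g : A → ℕ) {x : A} (xs : List A) → x ∈ xs → 0 < g x → 0 < sum (map g xs)
sum-pos⁺ g (y ∷ₗ xs) (here refl) p = <-≤-trans p (m≤m+n (g y) _)
sum-pos⁺ g (y ∷ₗ xs) (there x∈xs) p = <-≤-trans (sum-pos⁺ g xs x∈xs p) (m≤n+m _ (g y))

sumAll-pos⁻ : ∀ {n} k (f : Vec (Fin n) k → ℕ) → 0 < sumAll k f → ∃ λ js → 0 < f js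
sumAll-pos⁻ zero f p = [] , p
sumAll-pos⁻ {n} (suc k) f p with sum-pos⁻ (λ j → sumAll k (λ js → f (j ∷ js))) (allFin n) p
... | j , q with sumAll-pos⁻ k (λ js → f (j ∷ js)) q
... | js , r = j ∷ js , r

sumAll-pos⁺ : ∀ {n} k (f : Vec (Fin n) k → ℕ) js → 0 < f js → 0 < sumAll k f
sumAll-pos⁺ zero f [] p = p
sumAll-pos⁺ {n} (suc k) f (j ∷ js) p =
  sum-pos⁺ (λ j → sumAll k (λ js → f (j ∷ js))) (allFin n) (∈-allFin j) (sumAll-pos⁺ k (λ js → f (j ∷ js)) js p)

*-pos⁺ : ∀ {a b} → 0 < a → 0 < b → 0 < a * b
*-pos⁺ {suc a} {suc b} _ _ = z<s

*-pos⁻ : ∀ a b → 0 < a * b → 0 < a × 0 < b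
*-pos⁻ (suc a) (suc b) _ = z<s , z<s
*-pos⁻ (suc a) zero p = contradiction (subst (0 <_) (*-zeroʳ a) p) (<-irrefl refl)

product-pos⁺ : ∀ k (g : Fin k → ℕ) → (∀ t → 0 < g t) → 0 < product (tabulate g)
product-pos⁺ zero g _ = z<s
product-pos⁺ (suc k) g pos = *-pos⁺ (pos fzero) (product-pos⁺ k (g ∘ fsuc) (pos ∘ fsuc))

take-replicate : ∀ {A : Set} p q (x : A) → take p (replicate (p + q) x) ≡ replicate p x
take-replicate zero q x = refl
take-replicate (suc p) q x = cong (x ∷_) (take-replicate p q x)

drop-replicate : ∀ {A : Set} p q (x : A) → drop p (replicate (p + q) x) ≡ replicate q x
drop-replicate zero q x = refl
drop-replicate (suc p) q x = drop-replicate p q x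

chunks-replicate : ∀ {A : Set} m p (x : A) → chunks m p (replicate (m * p) x) ≡ replicate m (replicate p x)
chunks-replicate zero p x = refl
chunks-replicate (suc m) p x rewrite take-replicate p (m * p) x | drop-replicate p (m * p) x =
  cong (replicate p x ∷_) (chunks-replicate m p x)

allEq-sound : ∀ {n k} (j : Fin n) (xs : Vec (Fin n) k) → allEq j xs ≡ true → xs ≡ replicate k j
allEq-sound j [] _ = refl
allEq-sound j (x ∷ xs) e with x Data.Fin.≟ j
... | yes refl = cong (x ∷_) (allEq-sound j xs e)
... | no _ with () ← e

allEq-replicate : ∀ {n} k (j : Fin n) → allEq j (replicate k j) ≡ true
allEq-replicate zero j = refl
allEq-replicate (suc k) j with j Data.Fin.≟ j
... | yes _ = allEq-replicate k j
... | no j≢j = contradiction refl j≢j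

∈-tabulate⇔ : ∀ {n} (f : Fin n → Bool) u → u ∈ₛ tabulate f ⇔ T (f u)
∈-tabulate⇔ f u = mk⇔
  (λ u∈ → from T-≡ (trans (sym (lookup∘tabulate f u)) ([]=⇒lookup u∈)))
  (λ fu → lookup⇒[]= u (tabulate f) (trans (lookup∘tabulate f u) (to T-≡ fu)))

infixr 5 _◅_
data Walk {V : Set} (E : V → V → Set) : ℕ → V → V → Set where
  stop : ∀ {v} → Walk E zero v v
  _◅_  : ∀ {k u w v} → E u w → Walk E k w v → Walk E (suc k) u v

module _ {V : Set} {E : V → V → Set} where

  _++ʷ_ : ∀ {a b u w v} → Walk E a u w → Walk E b w v → Walk E (a + b) u v
  stop ++ʷ q = q
  (e ◅ p) ++ʷ q = e ◅ (p ++ʷ q)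

  walk-map : ∀ {F : V → V → Set} → (∀ {u v} → E u v → F u v) → ∀ {k u v} → Walk E k u v → Walk F k u v
  walk-map f stop = stop
  walk-map f (e ◅ p) = f e ◅ walk-map f p

  SameReach : ℕ → ℕ → V → Set
  SameReach a b v = ∀ u → Walk E a u v ⇔ Walk E b u v

  sameReach-prefix : ∀ {a b v} t → SameReach a b v → SameReach (t + a) (t + b) v
  sameReach-prefix zero same = same
  sameReach-prefix (suc t) same u = mk⇔
    (λ { (e ◅ p) → e ◅ to   (sameReach-prefix t same _) p })
    (λ { (e ◅ p) → e ◅ from (sameReach-prefix t same _) p })

  sameReach-periodic : ∀ {a b v} → a ≤ b → SameReach a b v → ∀ j → SameReach a (j * (b ∸ a) + a) v
  sameReach-periodic a≤b same zero u = mk⇔ (λ p → p) (λ p → p)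
  sameReach-periodic {a} {b} {v} a≤b same (suc j) u = mk⇔
    (to (shifted u) ∘ to (previous u)) (from (previous u) ∘ from (shifted u))
    where
    d = b ∸ a
    previous : SameReach a (j * d + a) v
    previous = sameReach-periodic a≤b same j
    length-eq : j * d + b ≡ suc j * d + a
    length-eq = begin
      j * d + b        ≡⟨ cong (j * d +_) (sym (m∸n+n≡m a≤b)) ⟩
      j * d + (d + a)  ≡⟨ sym (+-assoc (j * d) d a) ⟩
      j * d + d + a    ≡⟨ cong (_+ a) (+-comm (j * d) d) ⟩
      suc j * d + a    ∎
      where open ≡-Reasoning
    shifted : SameReach (j * d + a) (suc j * d + a) v
    shifted = subst (λ t → SameReach (j * d + a) t v) length-eq (sameReach-prefix (j * d) same)

DiagonallySupported : ∀ {n m₂} → Tensor n (suc (suc m₂)) → Set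
DiagonallySupported {n} {m₂} A = ∀ i j (rest : Vec (Fin n) m₂) → 0 < A (i ∷ j ∷ rest) → rest ≡ replicate m₂ j

Edge : ∀ {n r} → Tensor n (suc r) → Fin n → Fin n → Set
Edge {r = r} A u v = 0 < majorization r A u v

-- Both directions go by induction on k: a positive term
-- of the sum defining A·A^k is indexed by a constant vector (j, …, j), i.e. by an edge
-- u → j followed by a positive entry of M(A^k) in row j.
module DiagonalSupport {n m₂ : ℕ} (A : Tensor n (suc (suc m₂))) (diagonal : DiagonallySupported A) where

  private
    m₁ = suc m₂

  entry : ℕ → Fin n → Fin n → ℕ
  entry k u v = majorization (powE m₁ k) (pow m₁ k A) u v

  blocks : ∀ k → Fin n → Vec (Vec (Fin n) (powE m₁ k)) m₁
  blocks k v = chunks m₁ (powE m₁ k) (replicate (m₁ * powE m₁ k) v)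

  block-replicate : ∀ k v t → lookup (blocks k v) t ≡ replicate (powE m₁ k) v
  block-replicate k v t = trans (cong (λ bs → lookup bs t) (chunks-replicate m₁ (powE m₁ k) v)) (lookup-replicate t _)

  term : ℕ → Fin n → Fin n → Vec (Fin n) m₁ → ℕ
  term k u v js = A (u ∷ js) * product (tabulate (λ t → pow m₁ k A (lookup js t ∷ lookup (blocks k v) t)))

  walk⇒pos : ∀ k {u v} → Walk (Edge A) (suc k) u v → 0 < entry k u v
  walk⇒pos zero (e ◅ stop) = e
  walk⇒pos (suc k) {u} {v} (_◅_ {w = w} e p) =
    sumAll-pos⁺ m₁ (term k u v) (replicate m₁ w) (*-pos⁺ e (product-pos⁺ m₁ _ factor-pos))
    where
    factor-pos : ∀ t → 0 < pow m₁ k A (lookup (replicate m₁ w) t ∷ lookup (blocks k v) t)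
    factor-pos t = subst₂ (λ x xs → 0 < pow m₁ k A (x ∷ xs))
      (sym (lookup-replicate t w)) (sym (block-replicate k v t)) (walk⇒pos k p)

  pos⇒walk : ∀ k u v → 0 < entry k u v → Walk (Edge A) (suc k) u v
  pos⇒walk zero u v p = p ◅ stop
  pos⇒walk (suc k) u v p with sumAll-pos⁻ m₁ (term k u v) p
  ... | j ∷ rest , term-pos with *-pos⁻ (A (u ∷ j ∷ rest)) _ term-pos
  ... | a-pos , product-pos with diagonal u j rest a-pos
  ... | refl = a-pos ◅ pos⇒walk k j v (subst (λ xs → 0 < pow m₁ k A (j ∷ xs)) (block-replicate k v fzero) first-pos)
    where
    first-pos : 0 < pow m₁ k A (j ∷ lookup (blocks k v) fzero)
    first-pos = proj₁ (*-pos⁻ _ _ product-pos)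

  ∈S⇔walk : ∀ k u v → u ∈ₛ S m₁ k A v ⇔ Walk (Edge A) (suc k) u v
  ∈S⇔walk k u v = mk⇔
    (pos⇒walk k u v ∘ <ᵇ⇒< 0 _ ∘ to (∈-tabulate⇔ (λ x → 0 <ᵇ entry k x v) u))
    (from (∈-tabulate⇔ (λ x → 0 <ᵇ entry k x v) u) ∘ <⇒<ᵇ ∘ walk⇒pos k)

cycle-split : ∀ n' q r → suc q * suc n' + r ≡ (q * suc n' + n') + suc r
cycle-split = solve-∀

after-short-cycle : ∀ n' q → suc n' + suc (q * suc n' + 0) ≡ suc (suc q * suc n' + 0)
after-short-cycle = solve-∀

after-long-cycle : ∀ n' q r → suc (suc n') + suc (q * suc n' + r) ≡ suc (suc q * suc n' + suc r)
after-long-cycle = solve-∀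

-- (n² + 2) - 3n = (n - 1)(n - 2) for n = n' + 2
bound-identity : ∀ n' → suc (suc n') * suc (suc n') + 2 ≡ 3 * suc (suc n') + n' * suc n'
bound-identity = solve-∀

≡ᵇ-true : ∀ {m n} → m ≡ n → (m ≡ᵇ n) ≡ true
≡ᵇ-true {m} {n} m≡n = to T-≡ (≡⇒≡ᵇ m n m≡n)

≡ᵇ-true⁻ : ∀ {m n} → (m ≡ᵇ n) ≡ true → m ≡ n
≡ᵇ-true⁻ {m} {n} e = ≡ᵇ⇒≡ m n (from T-≡ e)

module Wielandt (n' : ℕ) where

  n N : ℕ
  n = suc (suc n')
  N = suc n'   -- the length n - 1 of the short cycle; the long cycle has length N + 1

  c : Fin n
  c = fromℕ< (m<n⇒m<1+n (n<1+n n'))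

  toℕ-c : toℕ c ≡ n'
  toℕ-c = toℕ-fromℕ< (m<n⇒m<1+n (n<1+n n'))

  -- Edges: 0 → n' and 0 → n' + 1 close the path n'+1 → n' → ⋯ → 0 into two cycles.
  data Step : Fin n → Fin n → Set where
    short : ∀ {v} → toℕ v ≡ n' → Step fzero v
    long  : ∀ {v} → toℕ v ≡ suc n' → Step fzero v
    down  : ∀ {u v} → toℕ u ≡ suc (toℕ v) → Step u v

  step⇒M1-pos : ∀ {u v} → Step u v → 0 < M1 n' u v
  step⇒M1-pos (short e) rewrite ≡ᵇ-true e = z<s
  step⇒M1-pos {v = v} (long e) with toℕ v ≡ᵇ n'
  ... | true = z<s
  ... | false rewrite ≡ᵇ-true e = z<s
  step⇒M1-pos {fzero} (down ())
  step⇒M1-pos {fsuc u} (down e) rewrite ≡ᵇ-true (suc-injective e) = z<s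


  M1-pos⇒step : ∀ u v → 0 < M1 n' u v → Step u v
  M1-pos⇒step fzero v p with toℕ v ≡ᵇ n' in e
  ... | true = short (≡ᵇ-true⁻ e)
  ... | false with toℕ v ≡ᵇ suc n' in e'
  ...   | true = long (≡ᵇ-true⁻ e')
  ...   | false with () ← p
  M1-pos⇒step (fsuc u) v p with toℕ u ≡ᵇ toℕ v in e
  ... | true = down (cong suc (≡ᵇ-true⁻ e))
  ... | false with () ← p

  descend : ∀ d (u : Fin n) → toℕ u ≡ d → Walk Step d u fzero
  descend zero fzero _ = stop
  descend (suc d) (fsuc u) e =
    down (cong suc (sym (toℕ-inject₁ u))) ◅ descend d (inject₁ u) (trans (toℕ-inject₁ u) (suc-injective e))

  short-cycle : Walk Step N fzero fzero
  short-cycle = short toℕ-c ◅ descend n' c toℕ-c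

  long-cycle : Walk Step (suc N) fzero fzero
  long-cycle = long (toℕ-fromℕ N) ◅ descend N (fromℕ N) (toℕ-fromℕ N)

  -- Lengths t = s·N + b with b ≤ s + 1: the sums of cycle lengths N and N + 1, possibly
  -- plus one.  A walk of length t + 1 from vertex 0 to c forces t to be of this form.
  ReturnLength : ℕ → Set
  ReturnLength t = Σ ℕ λ s → Σ ℕ λ b → b ≤ suc s × t ≡ s * N + b

  returnLength-short : ∀ {t} → ReturnLength t → ReturnLength (N + t)
  returnLength-short (s , b , b≤1+s , refl) = suc s , b , m≤n⇒m≤1+n b≤1+s , sym (+-assoc N (s * N) b)

  returnLength-long : ∀ {t} → ReturnLength t → ReturnLength (suc N + t)
  returnLength-long (s , b , b≤1+s , refl) =
    suc s , suc b , s≤s b≤1+s , trans (cong suc (sym (+-assoc N (s * N) b))) (sym (+-suc (N + s * N) b))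

  returnLength-residue : ∀ q r → r < N → ReturnLength (q * N + r) → r ≤ suc q
  returnLength-residue q r r<N (s , b , b≤1+s , e) with s ≤? q | b <? r
  ... | yes s≤q | yes b<r = contradiction (sym e) (<⇒≢ (+-mono-≤-< (*-monoˡ-≤ N s≤q) b<r))
  ... | yes s≤q | no b≮r = ≤-trans (≮⇒≥ b≮r) (≤-trans b≤1+s (s≤s s≤q))
  ... | no s≰q | _ = contradiction e (<⇒≢ (begin-strict
    q * N + r   <⟨ +-monoʳ-< (q * N) r<N ⟩
    q * N + N   ≡⟨ +-comm (q * N) N ⟩
    suc q * N   ≤⟨ *-monoˡ-≤ N (≰⇒> s≰q) ⟩
    s * N       ≤⟨ m≤m+n (s * N) b ⟩
    s * N + b   ∎))
    where open ≤-Reasoning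

  -- A necessary condition for a walk of length k from the vertex labelled x to c: it either
  -- passes through vertex 0 (first reached after x steps), or it descends straight to c.
  Admissible : ℕ → ℕ → Set
  Admissible k x = (x < k × ReturnLength (k ∸ suc x)) ⊎ (k + n' ≡ x)

  admissible-down : ∀ {k x} → Admissible k x → Admissible (suc k) (suc x)
  admissible-down (inj₁ (x<k , ρ)) = inj₁ (s≤s x<k , ρ)
  admissible-down (inj₂ e) = inj₂ (cong suc e)

  admissible-short : ∀ {k} → Admissible k n' → ReturnLength k
  admissible-short (inj₁ (n'<k , ρ)) = subst ReturnLength (m+[n∸m]≡n n'<k) (returnLength-short ρ)
  admissible-short {k} (inj₂ e) = subst ReturnLength (sym (+-cancelʳ-≡ n' k 0 e)) (0 , 0 , z≤n , refl)

  admissible-long : ∀ {k} → Admissible k (suc n') → ReturnLength k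
  admissible-long (inj₁ (N<k , ρ)) = subst ReturnLength (m+[n∸m]≡n N<k) (returnLength-long ρ)
  admissible-long {k} (inj₂ e) = subst ReturnLength (sym (+-cancelʳ-≡ n' k 1 e)) (0 , 1 , s≤s z≤n , refl)

  walk⇒admissible : ∀ {k u} → Walk Step k u c → Admissible k (toℕ u)
  walk⇒admissible stop = inj₂ (sym toℕ-c)
  walk⇒admissible (short e ◅ p) = inj₁ (z<s , admissible-short (subst (Admissible _) e (walk⇒admissible p)))
  walk⇒admissible (long e ◅ p) = inj₁ (z<s , admissible-long (subst (Admissible _) e (walk⇒admissible p)))
  walk⇒admissible (down e ◅ p) = subst (Admissible _) (sym e) (admissible-down (walk⇒admissible p))

  inadmissible : ∀ q r → q < n' → ¬ Admissible (suc (q * N + r)) (suc r)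
  inadmissible q r q<n' (inj₂ e) = <⇒≢ r<length (sym (suc-injective e))
    where
    r<length : r < q * N + r + n'
    r<length = <-≤-trans (m<m+n r (<-≤-trans z<s q<n')) (+-monoˡ-≤ n' (m≤n+m r (q * N)))
  inadmissible zero r _ (inj₁ (r+1<r+1 , _)) = n≮n r (s≤s⁻¹ r+1<r+1)
  inadmissible (suc q) r q<n' (inj₁ (_ , ρ)) =
    <⇒≱ q<n' (returnLength-residue q n' (n<1+n n') (subst ReturnLength remaining ρ))
    where
    remaining : suc q * N + r ∸ suc r ≡ q * N + n'
    remaining = trans (cong (_∸ suc r) (cycle-split n' q r)) (m+n∸n≡m (q * N + n') (suc r))

  div-mod : ∀ x → x ≡ x / N * N + x % N
  div-mod x = trans (m≡m%n+[m/n]*n x N) (+-comm (x % N) (x / N * N))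

  unreachable : ∀ x → x < n' * N → Σ (Fin n) λ u → ¬ Walk Step (suc x) u c
  unreachable x x<n'N = fromℕ< (s≤s (m%n<n x N)) , λ w →
    inadmissible (x / N) (x % N) (m<n*o⇒m/o<n x<n'N)
      (subst₂ Admissible (cong suc (div-mod x)) (toℕ-fromℕ< (s≤s (m%n<n x N))) (walk⇒admissible w))

  -- q·N + r + 1 = (q - r)·N + r·(N + 1) + 1 for r ≤ q: go round the short cycle q - r
  -- times and the long cycle r times, then take the edge 0 → c.
  from-zero : ∀ q r → r ≤ q → Walk Step (suc (q * N + r)) fzero c
  from-zero zero zero _ = short toℕ-c ◅ stop
  from-zero (suc q) zero _ =
    subst (λ t → Walk Step t fzero c) (after-short-cycle n' q) (short-cycle ++ʷ from-zero q zero z≤n)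
  from-zero (suc q) (suc r) (s≤s r≤q) =
    subst (λ t → Walk Step t fzero c) (after-long-cycle n' q r) (long-cycle ++ʷ from-zero q r r≤q)

  from-zero-large : ∀ t → n' * N < t → Walk Step t fzero c
  from-zero-large (suc x) (s≤s n'N≤x) =
    subst (λ t → Walk Step (suc t) fzero c) (sym (div-mod x)) (from-zero (x / N) (x % N) r≤q)
    where
    n'≤q : n' ≤ x / N
    n'≤q = subst (_≤ x / N) (m*n/n≡m n' N) (/-monoˡ-≤ N n'N≤x)
    r≤q : x % N ≤ x / N
    r≤q = ≤-trans (s≤s⁻¹ (m%n<n x N)) n'≤q

  -- Every vertex reaches c in every number of steps t ≥ n'·N + 1 + N: descend to 0 first.
  reach-all : ∀ t → suc (n' * N) + N ≤ t → ∀ u → Walk Step t u c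
  reach-all t bound u =
    subst (λ t → Walk Step t u c) (m+[n∸m]≡n u≤t) (descend (toℕ u) u refl ++ʷ from-zero-large (t ∸ toℕ u) rest-large)
    where
    u≤N : toℕ u ≤ N
    u≤N = s≤s⁻¹ (toℕ<n u)
    u≤t : toℕ u ≤ t
    u≤t = ≤-trans u≤N (≤-trans (m≤n+m N (suc (n' * N))) bound)
    rest-large : n' * N < t ∸ toℕ u
    rest-large = m+n≤o⇒m≤o∸n (suc (n' * N)) (≤-trans (+-monoʳ-≤ (suc (n' * N)) u≤N) bound)

module Proposition (n' m₂ : ℕ) where
  open Wielandt n'

  A : Tensor n (suc (suc m₂))
  A = A0 n' m₂

  A0-diagonal : DiagonallySupported A
  A0-diagonal i j rest p with allEq j rest in e
  ... | true = allEq-sound j rest e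
  ... | false with () ← p

  A0-majorization : ∀ i j → majorization (suc m₂) A i j ≡ M1 n' i j
  A0-majorization i j rewrite allEq-replicate m₂ j = refl

  open DiagonalSupport A A0-diagonal using (∈S⇔walk)

  ∈S⇔step-walk : ∀ x u → u ∈ₛ S (suc m₂) x A c ⇔ Walk Step (suc x) u c
  ∈S⇔step-walk x u = mk⇔
    (walk-map edge⇒step ∘ to (∈S⇔walk x u c))
    (from (∈S⇔walk x u c) ∘ walk-map step⇒edge)
    where
    edge⇒step : ∀ {u v} → Edge A u v → Step u v
    edge⇒step {u} {v} e = M1-pos⇒step u v (subst (0 <_) (A0-majorization u v) e)
    step⇒edge : ∀ {u v} → Step u v → Edge A u v
    step⇒edge {u} {v} s = subst (0 <_) (sym (A0-majorization u v)) (step⇒M1-pos s)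

  S-equal⇒sameReach : ∀ x y → S (suc m₂) x A c ≡ S (suc m₂) y A c → SameReach {E = Step} (suc x) (suc y) c
  S-equal⇒sameReach x y eq u = mk⇔
    (to (∈S⇔step-walk y u) ∘ subst (u ∈ₛ_) eq ∘ from (∈S⇔step-walk x u))
    (to (∈S⇔step-walk x u) ∘ subst (u ∈ₛ_) (sym eq) ∘ from (∈S⇔step-walk y u))

  bound : n * n + 2 ∸ 3 * n ≡ n' * N
  bound = trans (cong (_∸ 3 * n) (bound-identity n')) (m+n∸m≡n (3 * n) (n' * N))

  proper : ∀ k → 1 ≤ k → k ≤ n * n + 2 ∸ 3 * n → S (suc m₂) (k ∸ 1) A c ⊂ ⊤
  proper (suc x) _ k≤bound with unreachable x (subst (suc x ≤_) bound k≤bound)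
  ... | u , no-walk = (λ _ → ∈⊤) , u , ∈⊤ , no-walk ∘ to (∈S⇔step-walk x u)

  -- If S_k = S_l with k < l, the reach sets repeat with period l - k, so every vertex would
  -- reach c in k steps (as it does in every large number of steps); but one does not.
  distinct : ∀ k l → 1 ≤ k → k < l → l ≤ n * n + 2 ∸ 3 * n → S (suc m₂) (k ∸ 1) A c ≢ S (suc m₂) (l ∸ 1) A c
  distinct (suc x) (suc y) _ k<l l≤bound eq with unreachable x (subst (suc x ≤_) bound (≤-trans (<⇒≤ k<l) l≤bound))
  ... | u , no-walk = no-walk (from (sameReach-periodic (<⇒≤ k<l) (S-equal⇒sameReach x y eq) J u) (reach-all _ large u))
    where
    J = suc (n' * N) + N
    large : J ≤ J * (suc y ∸ suc x) + suc x
    large = ≤-trans (m≤m*n J (suc y ∸ suc x) {{>-nonZero (m<n⇒0<n∸m k<l)}}) (m≤m+n (J * (suc y ∸ suc x)) (suc x))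

proposition4p9 : (n' m₂ : ℕ) →
    let n = suc (suc n')
        c = fromℕ< (m<n⇒m<1+n (n<1+n n'))
        Sk = λ (k : ℕ) → S (suc m₂) (k ∸ 1) (A0 n' m₂) c
    in (∀ k → 1 ≤ k → k ≤ n * n + 2 ∸ 3 * n → Sk k ⊂ ⊤)
     × (∀ k l → 1 ≤ k → k < l → l ≤ n * n + 2 ∸ 3 * n → Sk k ≢ Sk l)
proposition4p9 n' m₂ = proper , distinct
  where open Proposition n' m₂
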